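{- Fix $\epsilon \in (0,1)$. There exists $n_0(\epsilon)$ such that the following holds for every integer $n \ge n_0(\epsilon)$. Set $t = \lceil 2\ln(\log_2 n)/(1-\epsilon) \rceil$ and $\Pi_{2} = x \prod_{i=1}^{t} (x^i + x^{i-1} + \cdots + x + 1) \in \mathbb{F}_2[x]$. Let $f(x) \in \mathbb{F}_2[x]$ with $\gcd(f, \Pi_2) = 1$ and $\deg f \le n$, and let \[ P(x) = \prod_{\substack{p(x) \in \mathbb{F}_2[x] \text{ irreducible},\ \deg p \le t,\ p(x) \nmid f(x)}} p(x). \] Then the polynomials $f(x) + a(x) P(x)$, for $a(x) \in \{1,\ x+1,\ x^2+x+1,\ \ldots,\ x^t + x^{t-1} + \cdots + x + 1\}$, have no irreducible factors of degree $\le t$, and these polynomials are pairwise coprime.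
   Context: All polynomials are in $\mathbb{F}_2[x]$; irreducible polynomials are non-constant. -}

module Defs where

open import Data.Bool using (Bool; true; false; _xor_; if_then_else_)
open import Data.List using (List; []; _∷_; replicate; length; foldr; map; upTo)
open import Data.Nat using (ℕ; zero; suc; _≤_)
open import Data.Product using (Σ; _×_)
open import Data.Sum using (_⊎_)
open import Relation.Binary.PropositionalEquality using (_≡_)

-- Polynomials over F₂: coefficient lists, lowest degree first.
-- Trailing zero coefficients are allowed; equality is taken up to them.
Poly : Set
Poly = List Bool

norm : Poly → Poly
norm [] = []
norm (b ∷ p) with norm p
... | [] = if b then true ∷ [] else []
... | q@(_ ∷ _) = b ∷ q

_≈_ : Poly → Poly → Set
p ≈ q = norm p ≡ norm q

infix 4 _≈_
infixl 6 _+ₚ_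
infixl 7 _*ₚ_

_+ₚ_ : Poly → Poly → Poly
[] +ₚ q = q
(a ∷ p) +ₚ [] = a ∷ p
(a ∷ p) +ₚ (b ∷ q) = (a xor b) ∷ (p +ₚ q)

_*ₚ_ : Poly → Poly → Poly
[] *ₚ q = []
(b ∷ p) *ₚ q = (if b then q else []) +ₚ (false ∷ (p *ₚ q))

one : Poly
one = true ∷ []

X : Poly
X = false ∷ true ∷ []

-- deg p ≤ d  (the zero polynomial has degree ≤ every d)
DegLe : Poly → ℕ → Set
DegLe p d = length (norm p) ≤ suc d

NonConst : Poly → Set
NonConst p = 2 ≤ length (norm p)

_∣ₚ_ : Poly → Poly → Set
d ∣ₚ f = Σ Poly (λ q → q *ₚ d ≈ f)

-- irreducible: non-constant, and every factorisation has a unit factor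
-- (the only unit of F₂[x] is 1)
Irreducible : Poly → Set
Irreducible p = NonConst p × (∀ a b → a *ₚ b ≈ p → a ≈ one ⊎ b ≈ one)

Coprime : Poly → Poly → Set
Coprime f g = ∀ d → d ∣ₚ f → d ∣ₚ g → d ≈ one

prodₚ : List Poly → Poly
prodₚ = foldr _*ₚ_ one

ones : ℕ → Poly
ones i = replicate (suc i) true

Π₂ : ℕ → Poly
Π₂ t = X *ₚ prodₚ (map (λ i → ones (suc i)) (upTo t))

module Submission where

-- With `P = ∏ L` and `aᵢ = xⁱ + … + 1`
-- the lemma is about `gᵢ = f + aᵢ·P`, and its proof is elementary ring
-- theory of F₂[x] plus two observations:
--   * a small irreducible `p` (degree ≤ t) divides `f` or `P`, never both,
--     and never `aᵢ` together with `f` (as `aᵢ ∣ Π₂ t` for `1 ≤ i ≤ t`);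
--     so `p ∣ gᵢ` is impossible whichever of `f`, `P` it divides;
--   * an irreducible factor of a common divisor of `gᵢ` and `gⱼ` divides
--     `gᵢ + gⱼ = (aᵢ + aⱼ)·P`, hence divides `P` or the nonzero `aᵢ + aⱼ`
--     of degree ≤ t; either way it is small, which the first point excludes.

open import Defs
open import Data.Bool using (Bool; true; false; _xor_; if_then_else_)
open import Data.Bool.Properties using (xor-same; xor-assoc; xor-comm; xor-identityʳ)
  renaming (_≟_ to _≟ᵇ_)
open import Data.Empty using (⊥-elim)
open import Data.List using (List; []; _∷_; length; map; upTo; _++_; concatMap)
import Data.List.Properties as List
open import Data.List.Membership.Propositional using (_∈_; lose; find)
open import Data.List.Membership.Propositional.Properties
  using (∈-map⁺; ∈-upTo⁺; ∈-++⁺ˡ; ∈-++⁺ʳ; ∈-concatMap⁺)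
open import Data.List.Relation.Unary.Any using (Any; here; there; any?; satisfied)
open import Data.List.Relation.Unary.AllPairs using (AllPairs)
open import Data.Nat using (ℕ; zero; suc; _+_; _⊔_; _∸_; _≤_; _<_; z≤n; s≤s; _≤?_; _<?_)
open import Data.Nat.Properties
  using (≤-refl; ≤-trans; ≤-reflexive; ≤-antisym; ≤-pred; <⇒≤; ≰⇒>; <⇒≱; <-cmp;
         m≤n⇒m<n∨m≡n; suc-injective; 0≢1+n; m≤m+n; m≤n+m; +-suc; m+n≡0⇒n≡0;
         m∸n+n≡m; m≤n⇒m⊔n≡n; m≥n⇒m⊔n≡m; ⊔-lub)
open import Data.Product using (∃-syntax; _×_; _,_; proj₁; proj₂)
open import Data.Sum using (_⊎_; inj₁; inj₂)
open import Data.Unit using (⊤; tt)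
open import Algebra using (CommutativeSemigroup)
import Algebra.Properties.CommutativeSemigroup
open import Relation.Binary using (Setoid)
import Relation.Binary.Reasoning.Setoid as SetoidReasoning
open import Relation.Binary.Definitions using (tri<; tri≈; tri>)
open import Relation.Binary.PropositionalEquality
  using (_≡_; _≢_; refl; sym; trans; cong; cong₂; subst; subst₂)
open import Relation.Nullary using (¬_; Dec; yes; no)
open import Relation.Nullary.Decidable using (_×-dec_)

step : Bool → Poly → Poly
step a []      = if a then true ∷ [] else []
step a (c ∷ r) = a ∷ c ∷ r

norm-cons : ∀ a p → norm (a ∷ p) ≡ step a (norm p)
norm-cons a p with norm p
... | []    = refl
... | _ ∷ _ = refl

step-injective : ∀ a b r s → step a r ≡ step b s → a ≡ b × r ≡ s
step-injective true  true  []      []      _    = refl , refl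
step-injective false false []      []      _    = refl , refl
step-injective true  false []      []      ()
step-injective false true  []      []      ()
step-injective true  _     []      (_ ∷ _) ()
step-injective false _     []      (_ ∷ _) ()
step-injective _     true  (_ ∷ _) []      ()
step-injective _     false (_ ∷ _) []      ()
step-injective _     _     (_ ∷ _) (_ ∷ _) refl = refl , refl

-- `_≈_` (equality of normal forms) is a function of its arguments, so Agda
-- cannot infer polynomials from a proof of it.  We work with the same
-- relation wrapped in a record, which makes both sides inferable.
infix 4 _≃_
record _≃_ (p q : Poly) : Set where
  constructor ≈⇒≃
  field ≃⇒≈ : p ≈ q
open _≃_ public

≃-refl : ∀ {p} → p ≃ p
≃-refl = ≈⇒≃ refl

≃-sym : ∀ {p q} → p ≃ q → q ≃ p
≃-sym (≈⇒≃ e) = ≈⇒≃ (sym e)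

≃-trans : ∀ {p q r} → p ≃ q → q ≃ r → p ≃ r
≃-trans (≈⇒≃ e) (≈⇒≃ e') = ≈⇒≃ (trans e e')

≃-setoid : Setoid _ _
≃-setoid = record
  { Carrier = Poly ; _≈_ = _≃_
  ; isEquivalence = record { refl = ≃-refl ; sym = ≃-sym ; trans = ≃-trans } }

module ≃-Reasoning = SetoidReasoning ≃-setoid

_≃?_ : ∀ p q → Dec (p ≃ q)
p ≃? q with List.≡-dec _≟ᵇ_ (norm p) (norm q)
... | yes e = yes (≈⇒≃ e)
... | no ne = no (λ e → ne (≃⇒≈ e))

-- Equality is compatible with the list structure.  Since `[]` and
-- `false ∷ []` have the same normal form, these lemmas also cover
-- comparisons with the zero polynomial.
≃-cons : ∀ {a b p q} → a ≡ b → p ≃ q → a ∷ p ≃ b ∷ q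
≃-cons {a} {_} {p} {q} refl (≈⇒≃ e) =
  ≈⇒≃ (trans (norm-cons a p) (trans (cong (step a) e) (sym (norm-cons a q))))

≃-zero-pad : [] ≃ false ∷ []
≃-zero-pad = ≈⇒≃ refl

≃-uncons : ∀ {a b p q} → a ∷ p ≃ b ∷ q → a ≡ b × p ≃ q
≃-uncons {a} {b} {p} {q} (≈⇒≃ e)
  with step-injective a b (norm p) (norm q)
         (trans (sym (norm-cons a p)) (trans e (norm-cons b q)))
... | a≡b , e' = a≡b , ≈⇒≃ e'

-- Coefficients.  Two polynomials are equal iff all their coefficients agree;
-- this reduces the additive laws of F₂[x] to laws of `_xor_`.
coef : Poly → ℕ → Bool
coef []      _       = false
coef (a ∷ p) zero    = a
coef (a ∷ p) (suc k) = coef p k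

coef-step : ∀ a r p → (∀ k → coef r k ≡ coef p k) →
            ∀ k → coef (step a r) k ≡ coef (a ∷ p) k
coef-step true  []      p h zero    = refl
coef-step false []      p h zero    = refl
coef-step true  []      p h (suc k) = h k
coef-step false []      p h (suc k) = h k
coef-step a     (c ∷ r) p h zero    = refl
coef-step a     (c ∷ r) p h (suc k) = h k

coef-norm : ∀ p k → coef (norm p) k ≡ coef p k
coef-norm []      k = refl
coef-norm (a ∷ p) k rewrite norm-cons a p = coef-step a (norm p) p (coef-norm p) k

≃⇒coef : ∀ {p q} → p ≃ q → ∀ k → coef p k ≡ coef q k
≃⇒coef {p} {q} (≈⇒≃ e) k =
  trans (sym (coef-norm p k)) (trans (cong (λ r → coef r k) e) (coef-norm q k))

coef⇒≃ : ∀ p q → (∀ k → coef p k ≡ coef q k) → p ≃ q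
coef⇒≃ []      []      h = ≃-refl
coef⇒≃ []      (b ∷ q) h =
  ≃-trans ≃-zero-pad (≃-cons (h zero) (coef⇒≃ [] q (λ k → h (suc k))))
coef⇒≃ (a ∷ p) []      h =
  ≃-trans (≃-cons (h zero) (coef⇒≃ p [] (λ k → h (suc k)))) (≃-sym ≃-zero-pad)
coef⇒≃ (a ∷ p) (b ∷ q) h = ≃-cons (h zero) (coef⇒≃ p q (λ k → h (suc k)))

coef-+ : ∀ p q k → coef (p +ₚ q) k ≡ coef p k xor coef q k
coef-+ []      q       k       = refl
coef-+ (a ∷ p) []      k       = sym (xor-identityʳ (coef (a ∷ p) k))
coef-+ (a ∷ p) (b ∷ q) zero    = refl
coef-+ (a ∷ p) (b ∷ q) (suc k) = coef-+ p q k

+ₚ-cong : ∀ {p p' q q'} → p ≃ p' → q ≃ q' → p +ₚ q ≃ p' +ₚ q'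
+ₚ-cong {p} {p'} {q} {q'} e e' = coef⇒≃ (p +ₚ q) (p' +ₚ q') λ k →
  trans (coef-+ p q k)
        (trans (cong₂ _xor_ (≃⇒coef e k) (≃⇒coef e' k)) (sym (coef-+ p' q' k)))

+ₚ-comm : ∀ p q → p +ₚ q ≃ q +ₚ p
+ₚ-comm p q = coef⇒≃ (p +ₚ q) (q +ₚ p) λ k →
  trans (coef-+ p q k) (trans (xor-comm (coef p k) (coef q k)) (sym (coef-+ q p k)))

+ₚ-assoc : ∀ p q r → (p +ₚ q) +ₚ r ≃ p +ₚ (q +ₚ r)
+ₚ-assoc p q r = coef⇒≃ ((p +ₚ q) +ₚ r) (p +ₚ (q +ₚ r)) λ k →
  trans (coef-+ (p +ₚ q) r k)
  (trans (cong (_xor coef r k) (coef-+ p q k))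
  (trans (xor-assoc (coef p k) (coef q k) (coef r k))
  (trans (cong (coef p k xor_) (sym (coef-+ q r k))) (sym (coef-+ p (q +ₚ r) k)))))

+ₚ-identityʳ : ∀ p → p +ₚ [] ≃ p
+ₚ-identityʳ []      = ≃-refl
+ₚ-identityʳ (a ∷ p) = ≃-refl

+ₚ-self : ∀ p → p +ₚ p ≃ []
+ₚ-self p = coef⇒≃ (p +ₚ p) [] λ k → trans (coef-+ p p k) (xor-same (coef p k))

+ₚ-commutativeSemigroup : CommutativeSemigroup _ _
+ₚ-commutativeSemigroup = record
  { Carrier = Poly ; _≈_ = _≃_ ; _∙_ = _+ₚ_
  ; isCommutativeSemigroup = record
    { isSemigroup = record
      { isMagma = record
        { isEquivalence = Setoid.isEquivalence ≃-setoid
        ; ∙-cong = +ₚ-cong }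
      ; assoc = +ₚ-assoc }
    ; comm = +ₚ-comm } }

open Algebra.Properties.CommutativeSemigroup +ₚ-commutativeSemigroup
  using ()
  renaming (interchange to +ₚ-interchange; x∙yz≈y∙xz to +ₚ-leftComm; xy∙z≈xz∙y to +ₚ-rightComm)

+ₚ-cancelˡ : ∀ p q → p +ₚ (p +ₚ q) ≃ q
+ₚ-cancelˡ p q = ≃-trans (≃-sym (+ₚ-assoc p p q)) (+ₚ-cong (+ₚ-self p) (≃-refl {q}))

+ₚ-cancelʳ : ∀ p q → (p +ₚ q) +ₚ q ≃ p
+ₚ-cancelʳ p q =
  ≃-trans (+ₚ-assoc p q q) (≃-trans (+ₚ-cong (≃-refl {p}) (+ₚ-self q)) (+ₚ-identityʳ p))

*ₚ-zeroˡ : ∀ {p} q → p ≃ [] → p *ₚ q ≃ []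
*ₚ-zeroˡ {[]}    q _ = ≃-refl
*ₚ-zeroˡ {a ∷ p} q e with ≃-uncons (≃-trans e ≃-zero-pad)
... | refl , p≃0 = ≃-trans (≃-cons refl (*ₚ-zeroˡ q p≃0)) (≃-sym ≃-zero-pad)

*ₚ-zeroʳ : ∀ p → p *ₚ [] ≃ []
*ₚ-zeroʳ []         = ≃-refl
*ₚ-zeroʳ (true ∷ p)  = ≃-trans (≃-cons refl (*ₚ-zeroʳ p)) (≃-sym ≃-zero-pad)
*ₚ-zeroʳ (false ∷ p) = ≃-trans (≃-cons refl (*ₚ-zeroʳ p)) (≃-sym ≃-zero-pad)

*ₚ-congˡ : ∀ {p p'} q → p ≃ p' → p *ₚ q ≃ p' *ₚ q
*ₚ-congˡ {[]}    {p'}     q e = ≃-sym (*ₚ-zeroˡ q (≃-sym e))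
*ₚ-congˡ {a ∷ p} {[]}     q e = *ₚ-zeroˡ q e
*ₚ-congˡ {a ∷ p} {b ∷ p'} q e with ≃-uncons e
... | refl , e' = +ₚ-cong ≃-refl (≃-cons refl (*ₚ-congˡ q e'))

scale-cong : ∀ b {q q'} → q ≃ q' → (if b then q else []) ≃ (if b then q' else [])
scale-cong true  e = e
scale-cong false e = ≃-refl

*ₚ-congʳ : ∀ p {q q'} → q ≃ q' → p *ₚ q ≃ p *ₚ q'
*ₚ-congʳ []      e = ≃-refl
*ₚ-congʳ (b ∷ p) e = +ₚ-cong (scale-cong b e) (≃-cons refl (*ₚ-congʳ p e))

*ₚ-cong : ∀ {p p' q q'} → p ≃ p' → q ≃ q' → p *ₚ q ≃ p' *ₚ q'
*ₚ-cong {p} {p'} {q} e e' = ≃-trans (*ₚ-congˡ q e) (*ₚ-congʳ p' e')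

scale-xor : ∀ a b q →
  (if a xor b then q else []) ≃ (if a then q else []) +ₚ (if b then q else [])
scale-xor true  true  q = ≃-sym (+ₚ-self q)
scale-xor true  false q = ≃-sym (+ₚ-identityʳ q)
scale-xor false b     q = ≃-refl

*ₚ-distribʳ : ∀ p p' q → (p +ₚ p') *ₚ q ≃ p *ₚ q +ₚ p' *ₚ q
*ₚ-distribʳ []      p'       q = ≃-refl
*ₚ-distribʳ (a ∷ p) []       q = ≃-sym (+ₚ-identityʳ _)
*ₚ-distribʳ (a ∷ p) (b ∷ p') q =
  ≃-trans (+ₚ-cong (scale-xor a b q) (≃-cons refl (*ₚ-distribʳ p p' q)))
          (+ₚ-interchange (if a then q else []) (if b then q else [])
                          (false ∷ p *ₚ q) (false ∷ p' *ₚ q))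

scale-+ : ∀ b q q' →
  (if b then q +ₚ q' else []) ≃ (if b then q else []) +ₚ (if b then q' else [])
scale-+ true  q q' = ≃-refl
scale-+ false q q' = ≃-refl

*ₚ-distribˡ : ∀ p q q' → p *ₚ (q +ₚ q') ≃ p *ₚ q +ₚ p *ₚ q'
*ₚ-distribˡ []      q q' = ≃-refl
*ₚ-distribˡ (b ∷ p) q q' =
  ≃-trans (+ₚ-cong (scale-+ b q q') (≃-cons refl (*ₚ-distribˡ p q q')))
          (+ₚ-interchange (if b then q else []) (if b then q' else [])
                          (false ∷ p *ₚ q) (false ∷ p *ₚ q'))

-- The recursion equation of `_*ₚ_` also holds in the second factor; this
-- is the inductive step of commutativity.
*ₚ-consʳ : ∀ p b q → p *ₚ (b ∷ q) ≃ (if b then p else []) +ₚ (false ∷ p *ₚ q)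
*ₚ-consʳ []         true  q = ≃-zero-pad
*ₚ-consʳ []         false q = ≃-zero-pad
*ₚ-consʳ (true ∷ p)  true  q =
  ≃-cons refl (≃-trans (+ₚ-cong ≃-refl (*ₚ-consʳ p true q)) (+ₚ-leftComm q p _))
*ₚ-consʳ (true ∷ p)  false q = ≃-cons refl (+ₚ-cong ≃-refl (*ₚ-consʳ p false q))
*ₚ-consʳ (false ∷ p) true  q = ≃-cons refl (*ₚ-consʳ p true q)
*ₚ-consʳ (false ∷ p) false q = ≃-cons refl (*ₚ-consʳ p false q)

*ₚ-comm : ∀ p q → p *ₚ q ≃ q *ₚ p
*ₚ-comm []      q = ≃-sym (*ₚ-zeroʳ q)
*ₚ-comm (a ∷ p) q =
  ≃-trans (+ₚ-cong ≃-refl (≃-cons refl (*ₚ-comm p q))) (≃-sym (*ₚ-consʳ q a p))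

scale-* : ∀ b q r → (if b then q else []) *ₚ r ≃ (if b then q *ₚ r else [])
scale-* true  q r = ≃-refl
scale-* false q r = ≃-refl

*ₚ-assoc : ∀ p q r → (p *ₚ q) *ₚ r ≃ p *ₚ (q *ₚ r)
*ₚ-assoc []      q r = ≃-refl
*ₚ-assoc (b ∷ p) q r =
  ≃-trans (*ₚ-distribʳ (if b then q else []) (false ∷ p *ₚ q) r)
          (+ₚ-cong (scale-* b q r) (≃-cons refl (*ₚ-assoc p q r)))

*ₚ-identityˡ : ∀ p → one *ₚ p ≃ p
*ₚ-identityˡ p = ≃-trans (+ₚ-cong (≃-refl {p}) (≃-sym ≃-zero-pad)) (+ₚ-identityʳ p)

*ₚ-identityʳ : ∀ p → p *ₚ one ≃ p
*ₚ-identityʳ p = ≃-trans (*ₚ-comm p one) (*ₚ-identityˡ p)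

-- Degree.  `len p = length (norm p)` is `deg p + 1` for `p ≄ 0` and `0` for
-- the zero polynomial; the statement's `DegLe p d` is `len p ≤ suc d`.
len : Poly → ℕ
len p = length (norm p)

len-cong : ∀ {p q} → p ≃ q → len p ≡ len q
len-cong (≈⇒≃ e) = cong length e

len0⇒≃0 : ∀ p → len p ≡ 0 → p ≃ []
len0⇒≃0 p e with norm p in np
... | [] = ≈⇒≃ np

Normal : Poly → Set
Normal []          = ⊤
Normal (a ∷ [])    = a ≡ true
Normal (a ∷ b ∷ r) = Normal (b ∷ r)

step-normal : ∀ a r → Normal r → Normal (step a r)
step-normal true  []      _ = refl
step-normal false []      _ = tt
step-normal a     (c ∷ r) h = h

norm-normal : ∀ p → Normal (norm p)
norm-normal []      = tt
norm-normal (a ∷ p) rewrite norm-cons a p = step-normal a (norm p) (norm-normal p)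

normal-fixed : ∀ r → Normal r → norm r ≡ r
normal-fixed []          _    = refl
normal-fixed (a ∷ [])    refl = refl
normal-fixed (a ∷ b ∷ r) h    =
  trans (norm-cons a (b ∷ r)) (cong (step a) (normal-fixed (b ∷ r) h))

norm-≃ : ∀ p → norm p ≃ p
norm-≃ p = ≈⇒≃ (normal-fixed (norm p) (norm-normal p))

normal-top : ∀ r m → Normal r → length r ≡ suc m → coef r m ≡ true
normal-top (a ∷ [])    zero    h _ = h
normal-top (a ∷ b ∷ r) (suc m) h e = normal-top (b ∷ r) m h (suc-injective e)

coef-top : ∀ p {m} → len p ≡ suc m → coef p m ≡ true
coef-top p {m} e = trans (sym (coef-norm p m)) (normal-top (norm p) m (norm-normal p) e)

coef-beyond : ∀ p {k} → len p ≤ k → coef p k ≡ false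
coef-beyond p {k} h = trans (sym (coef-norm p k)) (beyond (norm p) k h)
  where
  beyond : ∀ r k → length r ≤ k → coef r k ≡ false
  beyond []      k       _       = refl
  beyond (a ∷ r) (suc k) (s≤s h) = beyond r k h

len-bounded : ∀ p {n} → (∀ k → n ≤ k → coef p k ≡ false) → len p ≤ n
len-bounded p {n} h with len p ≤? n
... | yes le = le
... | no gt with len p in lp | ≰⇒> gt
...   | suc m | s≤s n≤m with () ← trans (sym (coef-top p lp)) (h m n≤m)

coef-true⇒len : ∀ p {m} → coef p m ≡ true → m < len p
coef-true⇒len p {m} c with len p ≤? m
... | yes le with () ← trans (sym c) (coef-beyond p le)
... | no gt = ≰⇒> gt

len-+-< : ∀ a c → len a < len c → len (a +ₚ c) ≡ len c
len-+-< a c lt with len c in lc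
... | suc m = ≤-antisym upper lower
  where
  upper : len (a +ₚ c) ≤ suc m
  upper = len-bounded (a +ₚ c) λ k m<k →
    trans (coef-+ a c k)
          (cong₂ _xor_ (coef-beyond a (<⇒≤ (≤-trans lt m<k)))
                       (coef-beyond c (≤-trans (≤-reflexive lc) m<k)))
  lower : suc m ≤ len (a +ₚ c)
  lower = coef-true⇒len (a +ₚ c)
    (trans (coef-+ a c m) (cong₂ _xor_ (coef-beyond a (≤-pred lt)) (coef-top c lc)))

len-+-≡ : ∀ a c {m} → len a ≡ suc m → len c ≡ suc m → len (a +ₚ c) ≤ m
len-+-≡ a c {m} la lc = len-bounded (a +ₚ c) λ k m≤k →
  trans (coef-+ a c k) (cancel k (m≤n⇒m<n∨m≡n m≤k))
  where
  cancel : ∀ k → m < k ⊎ m ≡ k → coef a k xor coef c k ≡ false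
  cancel k (inj₁ m<k) = cong₂ _xor_ (coef-beyond a (≤-trans (≤-reflexive la) m<k))
                                    (coef-beyond c (≤-trans (≤-reflexive lc) m<k))
  cancel k (inj₂ refl) = cong₂ _xor_ (coef-top a la) (coef-top c lc)

len-cons : ∀ b p {j} → len p ≡ suc j → len (b ∷ p) ≡ suc (suc j)
len-cons b p {j} lp = trans (cong length (norm-cons b p)) (len-step (norm p) lp)
  where
  len-step : ∀ r → length r ≡ suc j → length (step b r) ≡ suc (suc j)
  len-step (c ∷ r) e = cong suc e

len-scale : ∀ b q → len (if b then q else []) ≤ len q
len-scale true  q = ≤-refl
len-scale false q = z≤n

nonzero-constant : ∀ b p q {j} → p ≃ [] → len (b ∷ p) ≡ suc j →
                   (b ∷ p) *ₚ q ≃ q × j ≡ 0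
nonzero-constant true  p q p≃0 lp with trans (sym lp) (len-cong (≃-cons {true} refl p≃0))
... | refl = ≃-trans (+ₚ-cong (≃-refl {q}) (≃-cons {false} refl (*ₚ-zeroˡ q p≃0)))
                     (*ₚ-identityˡ q) , refl
nonzero-constant false p q p≃0 lp with () ← trans (sym lp) (len-cong (≃-cons {false} refl p≃0))

len-* : ∀ p q {j m} → len p ≡ suc j → len q ≡ suc m → len (p *ₚ q) ≡ suc (j + m)
len-* (b ∷ p) q {m = m} lbp lq with len p in lp
... | zero with nonzero-constant b p q (len0⇒≃0 p lp) lbp
...   | bp·q≃q , refl = trans (len-cong bp·q≃q) lq
len-* (b ∷ p) q {m = m} lbp lq | suc j' with suc-injective (trans (sym (len-cons b p lp)) lbp)
... | refl = trans (len-+-< (if b then q else []) (false ∷ p *ₚ q) shorter) lxpq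
  where
  lxpq : len (false ∷ p *ₚ q) ≡ suc (suc j' + m)
  lxpq = len-cons false (p *ₚ q) (len-* p q lp lq)
  shorter : len (if b then q else []) < len (false ∷ p *ₚ q)
  shorter = ≤-trans (s≤s (≤-trans (len-scale b q) (≤-reflexive lq)))
                    (≤-trans (s≤s (s≤s (m≤n+m m j'))) (≤-reflexive (sym lxpq)))

nonzero-len : ∀ p → ¬ p ≃ [] → ∃[ m ] len p ≡ suc m
nonzero-len p p≄0 with len p in lp
... | zero  = ⊥-elim (p≄0 (len0⇒≃0 p lp))
... | suc m = m , refl

factor-lens : ∀ a b → ¬ a *ₚ b ≃ [] →
  ∃[ j ] ∃[ m ] len a ≡ suc j × len b ≡ suc m × len (a *ₚ b) ≡ suc (j + m)
factor-lens a b ab≄0 with nonzero-len a a≄0 | nonzero-len b b≄0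
  where
  a≄0 : ¬ a ≃ []
  a≄0 a≃0 = ab≄0 (*ₚ-zeroˡ b a≃0)
  b≄0 : ¬ b ≃ []
  b≄0 b≃0 = ab≄0 (≃-trans (*ₚ-congʳ a b≃0) (*ₚ-zeroʳ a))
... | j , la | m , lb = j , m , la , lb , len-* a b la lb

len1⇒≃one : ∀ d → len d ≡ 1 → d ≃ one
len1⇒≃one d ld = coef⇒≃ d one λ where
  zero    → coef-top d ld
  (suc k) → coef-beyond d (≤-trans (≤-reflexive ld) (s≤s z≤n))

one≄0 : ¬ one ≃ []
one≄0 e with () ← len-cong e

infix 4 _∣_
record _∣_ (d f : Poly) : Set where
  constructor divides
  field
    quotient : Poly
    equation : quotient *ₚ d ≃ f

∣ₚ⇒∣ : ∀ {d f} → d ∣ₚ f → d ∣ f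
∣ₚ⇒∣ (q , e) = divides q (≈⇒≃ e)

∣⇒∣ₚ : ∀ {d f} → d ∣ f → d ∣ₚ f
∣⇒∣ₚ (divides q e) = q , ≃⇒≈ e

∣-resp : ∀ {d d' f f'} → d ≃ d' → f ≃ f' → d ∣ f → d' ∣ f'
∣-resp {d} {d'} d≃d' f≃f' (divides q e) =
  divides q (≃-trans (*ₚ-congʳ q (≃-sym d≃d')) (≃-trans e f≃f'))

∣-refl : ∀ {d} → d ∣ d
∣-refl {d} = divides one (*ₚ-identityˡ d)

∣-trans : ∀ {a b c} → a ∣ b → b ∣ c → a ∣ c
∣-trans {a} (divides q e) (divides q' e') =
  divides (q' *ₚ q) (≃-trans (*ₚ-assoc q' q a) (≃-trans (*ₚ-congʳ q' e) e'))

∣-+ : ∀ {d a b} → d ∣ a → d ∣ b → d ∣ a +ₚ b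
∣-+ {d} (divides q e) (divides q' e') =
  divides (q +ₚ q') (≃-trans (*ₚ-distribʳ q q' d) (+ₚ-cong e e'))

∣-+-cancelˡ : ∀ {d a b} → d ∣ a +ₚ b → d ∣ a → d ∣ b
∣-+-cancelˡ {a = a} {b} d∣a+b d∣a = ∣-resp ≃-refl (+ₚ-cancelˡ a b) (∣-+ d∣a d∣a+b)

∣-+-cancelʳ : ∀ {d a b} → d ∣ a +ₚ b → d ∣ b → d ∣ a
∣-+-cancelʳ {a = a} {b} d∣a+b d∣b = ∣-resp ≃-refl (+ₚ-cancelʳ a b) (∣-+ d∣a+b d∣b)

∣-*ˡ : ∀ {d b} a → d ∣ b → d ∣ a *ₚ b
∣-*ˡ {d} a (divides q e) = divides (a *ₚ q) (≃-trans (*ₚ-assoc a q d) (*ₚ-congʳ a e))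

∣-*ʳ : ∀ {d a} b → d ∣ a → d ∣ a *ₚ b
∣-*ʳ {a = a} b d∣a = ∣-resp ≃-refl (*ₚ-comm b a) (∣-*ˡ b d∣a)

∣-zero : ∀ d → d ∣ []
∣-zero d = divides [] ≃-refl

zero-∣ : ∀ {f} → [] ∣ f → f ≃ []
zero-∣ (divides q e) = ≃-trans (≃-sym e) (*ₚ-zeroʳ q)

len-∣ : ∀ {d f} → ¬ f ≃ [] → d ∣ f → len d ≤ len f
len-∣ {d} {f} f≄0 (divides q e) with factor-lens q d (λ qd≃0 → f≄0 (≃-trans (≃-sym e) qd≃0))
... | j , m , _ , ld , lqd =
  ≤-trans (≤-reflexive ld)
          (≤-trans (s≤s (m≤n+m m j)) (≤-reflexive (trans (sym lqd) (len-cong e))))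

unit-∣ : ∀ {d} → d ∣ one → d ≃ one
unit-∣ {d} (divides q e) with factor-lens q d (λ qd≃0 → one≄0 (≃-trans (≃-sym e) qd≃0))
... | j , m , _ , ld , lqd =
  len1⇒≃one d (trans ld (cong suc (m+n≡0⇒n≡0 j (suc-injective (trans (sym lqd) (len-cong e))))))

xpow : ℕ → Poly
xpow zero    = one
xpow (suc k) = false ∷ xpow k

len-xpow : ∀ k → len (xpow k) ≡ suc k
len-xpow zero    = refl
len-xpow (suc k) = len-cons false (xpow k) (len-xpow k)

record DivMod (f d : Poly) : Set where
  field
    quot rem  : Poly
    quot-rem  : f ≃ quot *ₚ d +ₚ rem
    rem-small : len rem < len d

-- Schoolbook long division: while `deg f ≥ deg d`, cancel the leading term
-- of `f` by adding `x^(deg f - deg d) · d`; this lowers the degree.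
divMod : ∀ f d → ¬ d ≃ [] → DivMod f d
divMod f₀ d d≄0 with nonzero-len d d≄0
... | m , ld = reduce (len f₀) f₀ ≤-refl
  where
  reduce : ∀ N f → len f ≤ N → DivMod f d
  reduce N f lf≤N with len f ≤? m
  ... | yes small = record
    { quot = [] ; rem = f ; quot-rem = ≃-refl
    ; rem-small = ≤-trans (s≤s small) (≤-reflexive (sym ld)) }
  ... | no big with len f in lf | ≰⇒> big
  ...   | suc n | s≤s m≤n with N | lf≤N
  ...     | suc N' | s≤s n≤N' = record
    { quot = q' +ₚ xpow k ; rem = r' ; quot-rem = quot-rem ; rem-small = r'<d }
    where
    k : ℕ
    k = n ∸ m
    s : Poly
    s = xpow k *ₚ d
    ls : len s ≡ suc n
    ls = trans (len-* (xpow k) d (len-xpow k) ld) (cong suc (m∸n+n≡m m≤n))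
    open DivMod (reduce N' (f +ₚ s) (≤-trans (len-+-≡ f s lf ls) n≤N'))
      renaming (quot to q'; rem to r'; quot-rem to f+s≃q'd+r'; rem-small to r'<d)
    quot-rem : f ≃ (q' +ₚ xpow k) *ₚ d +ₚ r'
    quot-rem = begin
      f                          ≈⟨ +ₚ-cancelʳ f s ⟨
      (f +ₚ s) +ₚ s              ≈⟨ +ₚ-cong f+s≃q'd+r' ≃-refl ⟩
      (q' *ₚ d +ₚ r') +ₚ s       ≈⟨ +ₚ-rightComm (q' *ₚ d) r' s ⟩
      (q' *ₚ d +ₚ s) +ₚ r'       ≈⟨ +ₚ-cong (*ₚ-distribʳ q' (xpow k) d) ≃-refl ⟨
      (q' +ₚ xpow k) *ₚ d +ₚ r'  ∎
      where open ≃-Reasoning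

-- Divisibility is decidable: divide and test the remainder.
∣-dec : ∀ d f → Dec (d ∣ f)
∣-dec d f with d ≃? [] | f ≃? []
... | yes d≃0 | yes f≃0 = yes (divides [] (≃-sym f≃0))
... | yes d≃0 | no f≄0  = no λ d∣f → f≄0 (zero-∣ (∣-resp d≃0 ≃-refl d∣f))
... | no d≄0  | _ with divMod f d d≄0
...   | record { quot = q ; rem = r ; quot-rem = f≃qd+r ; rem-small = r<d } with r ≃? []
...     | yes r≃0 = yes (divides q (≃-sym
  (≃-trans f≃qd+r (≃-trans (+ₚ-cong ≃-refl r≃0) (+ₚ-identityʳ (q *ₚ d))))))
...     | no r≄0  = no λ d∣f →
  <⇒≱ r<d (len-∣ r≄0 (∣-+-cancelˡ (∣-resp ≃-refl f≃qd+r d∣f) (divides q ≃-refl)))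

record Bezout (a b : Poly) : Set where
  field
    gcd u v  : Poly
    gcd∣a    : gcd ∣ a
    gcd∣b    : gcd ∣ b
    identity : u *ₚ a +ₚ v *ₚ b ≃ gcd

-- The extended Euclidean algorithm, by recursion on `deg b`:
-- from `a = q·b + r` and `g = u·b + v·r` we get `g = v·a + (v·q + u)·b`.
bezout : ∀ a b → Bezout a b
bezout a₀ b₀ = euclidean-algorithm (len b₀) a₀ b₀ ≤-refl
  where
  euclidean-algorithm : ∀ N a b → len b ≤ N → Bezout a b
  euclidean-algorithm N a b lb≤N with b ≃? []
  ... | yes b≃0 = record
    { gcd = a ; u = one ; v = [] ; gcd∣a = ∣-refl ; gcd∣b = ∣-resp ≃-refl (≃-sym b≃0) (∣-zero a)
    ; identity = ≃-trans (+ₚ-identityʳ _) (*ₚ-identityˡ a) }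
  euclidean-algorithm zero    a b lb≤N | no b≄0 = ⊥-elim (b≄0 (len0⇒≃0 b (≤-antisym lb≤N z≤n)))
  euclidean-algorithm (suc N) a b lb≤N | no b≄0 = record
    { gcd = gcd ; u = v ; v = v *ₚ q +ₚ u
    ; gcd∣a = ∣-resp ≃-refl (≃-sym a≃qb+r) (∣-+ (∣-*ˡ q gcd∣b) gcd∣r)
    ; gcd∣b = gcd∣b
    ; identity = identity' }
    where
    open DivMod (divMod a b b≄0) renaming (quot to q; rem to r; quot-rem to a≃qb+r)
    open Bezout (euclidean-algorithm N b r (≤-pred (≤-trans rem-small lb≤N)))
      renaming (gcd∣a to gcd∣b; gcd∣b to gcd∣r)
    identity' : v *ₚ a +ₚ (v *ₚ q +ₚ u) *ₚ b ≃ gcd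
    identity' = begin
      v *ₚ a +ₚ (v *ₚ q +ₚ u) *ₚ b
        ≈⟨ +ₚ-cong (≃-trans (*ₚ-congʳ v a≃qb+r) (*ₚ-distribˡ v (q *ₚ b) r))
                   (≃-trans (*ₚ-distribʳ (v *ₚ q) u b) (+ₚ-cong (*ₚ-assoc v q b) ≃-refl)) ⟩
      (v *ₚ (q *ₚ b) +ₚ v *ₚ r) +ₚ (v *ₚ (q *ₚ b) +ₚ u *ₚ b)
        ≈⟨ +ₚ-interchange (v *ₚ (q *ₚ b)) (v *ₚ r) (v *ₚ (q *ₚ b)) (u *ₚ b) ⟩
      (v *ₚ (q *ₚ b) +ₚ v *ₚ (q *ₚ b)) +ₚ (v *ₚ r +ₚ u *ₚ b)
        ≈⟨ +ₚ-cong (+ₚ-self (v *ₚ (q *ₚ b))) (+ₚ-comm (v *ₚ r) (u *ₚ b)) ⟩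
      u *ₚ b +ₚ v *ₚ r
        ≈⟨ identity ⟩
      gcd ∎
      where open ≃-Reasoning

unit-factor : ∀ {c g p} → c ≃ one → c *ₚ g ≃ p → g ≃ p
unit-factor {c} {g} c≃1 cg≃p =
  ≃-trans (≃-sym (*ₚ-identityˡ g)) (≃-trans (*ₚ-congˡ g (≃-sym c≃1)) cg≃p)

-- If `p ∤ a`, the gcd
-- `g` of `p` and `a` divides the irreducible `p` and is not associate to it,
-- so `g = 1 = u·p + v·a` and `b = u·p·b + v·(a·b)` is divisible by `p`.
euclid : ∀ {p} a b → Irreducible p → p ∣ a *ₚ b → p ∣ a ⊎ p ∣ b
euclid {p} a b (_ , p-irr) p∣ab with ∣-dec p a
... | yes p∣a = inj₁ p∣a
... | no p∤a with bezout p a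
...   | record { gcd = g ; u = u ; v = v ; gcd∣a = g∣p ; gcd∣b = g∣a ; identity = up+va≃g }
  with g∣p
...   | divides c cg≃p with p-irr c g (≃⇒≈ cg≃p)
...     | inj₁ c≈one = ⊥-elim (p∤a (∣-resp (unit-factor (≈⇒≃ {c} {one} c≈one) cg≃p) ≃-refl g∣a))
...     | inj₂ g≈one = inj₂ (∣-resp ≃-refl b-expansion (∣-+ p∣upb p∣vab))
  where
  p∣upb : p ∣ (u *ₚ p) *ₚ b
  p∣upb = ∣-*ʳ b (∣-*ˡ u ∣-refl)
  p∣vab : p ∣ (v *ₚ a) *ₚ b
  p∣vab = ∣-resp ≃-refl (≃-sym (*ₚ-assoc v a b)) (∣-*ˡ v p∣ab)
  up+va≃1 : u *ₚ p +ₚ v *ₚ a ≃ one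
  up+va≃1 = ≃-trans up+va≃g (≈⇒≃ {g} {one} g≈one)
  b-expansion : (u *ₚ p) *ₚ b +ₚ (v *ₚ a) *ₚ b ≃ b
  b-expansion = ≃-trans (≃-sym (*ₚ-distribʳ (u *ₚ p) (v *ₚ a) b))
                        (≃-trans (*ₚ-congˡ b up+va≃1) (*ₚ-identityˡ b))

irreducible-nonunit : ∀ {p} → Irreducible p → ¬ p ≃ one
irreducible-nonunit (nonconst , _) p≃one
  with ≤-trans nonconst (≤-reflexive (len-cong p≃one))
... | s≤s ()

ProperDivisor : Poly → Poly → Set
ProperDivisor d c = 2 ≤ len c × len c < len d × c ∣ d

proper-divisor? : ∀ d c → Dec (ProperDivisor d c)
proper-divisor? d c = (2 ≤? len c) ×-dec ((len c <? len d) ×-dec ∣-dec c d)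

irreducible-if-no-proper-divisor : ∀ d → 2 ≤ len d →
  (∀ c → ¬ ProperDivisor d c) → Irreducible d
irreducible-if-no-proper-divisor d 2≤d no-divisor = 2≤d , factors-trivial
  where
  factors-trivial : ∀ a b → a *ₚ b ≈ d → a ≈ one ⊎ b ≈ one
  factors-trivial a b ab≈d
    with factor-lens a b (λ ab≃0 → d≄0 (≃-trans (≃-sym (≈⇒≃ ab≈d)) ab≃0))
    where
    d≄0 : ¬ d ≃ []
    d≄0 d≃0 with () ← ≤-trans 2≤d (≤-reflexive (len-cong d≃0))
  ... | zero  , _     , la , _  , _   = inj₁ (≃⇒≈ (len1⇒≃one a la))
  ... | suc j , zero  , _  , lb , _   = inj₂ (≃⇒≈ (len1⇒≃one b lb))
  ... | suc j , suc m , la , lb , lab = ⊥-elim (no-divisor a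
        ( ≤-trans (s≤s (s≤s z≤n)) (≤-reflexive (sym la))
        , ≤-trans (s≤s (≤-reflexive la))
            (≤-trans (s≤s (s≤s (s≤s (m≤m+n j m))))
                     (≤-reflexive (trans (cong (λ x → suc (suc x)) (sym (+-suc j m)))
                                         (trans (sym lab) (len-cong (≈⇒≃ {a *ₚ b} {d} ab≈d))))))
        , divides b (≃-trans (*ₚ-comm b a) (≈⇒≃ ab≈d))))

polys : ℕ → List Poly
polys zero    = [] ∷ []
polys (suc n) = map (false ∷_) (polys n) ++ map (true ∷_) (polys n)

polys-complete : ∀ p → p ∈ polys (length p)
polys-complete []          = here refl
polys-complete (false ∷ p) = ∈-++⁺ˡ (∈-map⁺ (false ∷_) (polys-complete p))
polys-complete (true ∷ p)  =
  ∈-++⁺ʳ (map (false ∷_) (polys (length p))) (∈-map⁺ (true ∷_) (polys-complete p))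

polys< : ℕ → List Poly
polys< n = concatMap polys (upTo n)

norm-∈-polys< : ∀ p {n} → len p < n → norm p ∈ polys< n
norm-∈-polys< p lt = ∈-concatMap⁺ polys (lose (∈-upTo⁺ lt) (polys-complete (norm p)))

-- Every polynomial of degree ≥ 1 has an irreducible factor: search the
-- finitely many candidates for a proper divisor; if there is one, recurse
-- on it, otherwise the polynomial itself is irreducible.
irreducible-factor : ∀ d → 2 ≤ len d → ∃[ p ] Irreducible p × p ∣ d
irreducible-factor d₀ = search (len d₀) d₀ ≤-refl
  where
  search : ∀ N d → len d ≤ N → 2 ≤ len d → ∃[ p ] Irreducible p × p ∣ d
  search N d ld≤N 2≤d with any? (proper-divisor? d) (polys< (len d))
  ... | no none = d , irreducible-if-no-proper-divisor d 2≤d no-divisor , ∣-refl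
    where
    no-divisor : ∀ c → ¬ ProperDivisor d c
    no-divisor c (2≤c , c<d , c∣d) = none (lose (norm-∈-polys< c c<d)
      ( ≤-trans 2≤c (≤-reflexive (sym (len-cong (norm-≃ c))))
      , ≤-trans (s≤s (≤-reflexive (len-cong (norm-≃ c)))) c<d
      , ∣-resp (≃-sym (norm-≃ c)) ≃-refl c∣d))
  ... | yes found with satisfied found
  ...   | c , 2≤c , c<d , c∣d with N | ld≤N
  ...     | zero   | ld≤0 with () ← ≤-trans 2≤d ld≤0
  ...     | suc N' | ld≤1+N' with search N' c (≤-pred (≤-trans c<d ld≤1+N')) 2≤c
  ...       | p , p-irr , p∣c = p , p-irr , ∣-trans p∣c c∣d

X-irreducible : Irreducible X
X-irreducible = irreducible-if-no-proper-divisor X (s≤s (s≤s z≤n))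
  λ c (2≤c , c<2 , _) → <⇒≱ c<2 2≤c

-- Every non-unit has an irreducible factor (`x` divides zero).
nonunit-irreducible-factor : ∀ d → ¬ d ≃ one → ∃[ p ] Irreducible p × p ∣ d
nonunit-irreducible-factor d d≄1 with d ≃? []
... | yes d≃0 = X , X-irreducible , ∣-resp ≃-refl (≃-sym d≃0) (∣-zero X)
... | no d≄0 with nonzero-len d d≄0
...   | zero  , ld = ⊥-elim (d≄1 (len1⇒≃one d ld))
...   | suc m , ld = irreducible-factor d (≤-trans (s≤s (s≤s z≤n)) (≤-reflexive (sym ld)))

∈-∣-prodₚ : ∀ {q} L → q ∈ L → q ∣ prodₚ L
∈-∣-prodₚ (q ∷ L) (here refl) = ∣-*ʳ (prodₚ L) ∣-refl
∈-∣-prodₚ (q ∷ L) (there q∈L) = ∣-*ˡ q (∈-∣-prodₚ L q∈L)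

irreducible-∣-prodₚ : ∀ {p} L → (∀ q → q ∈ L → Irreducible q) → Irreducible p →
  p ∣ prodₚ L → ∃[ q ] q ∈ L × p ≃ q
irreducible-∣-prodₚ [] _ p-irr p∣1 = ⊥-elim (irreducible-nonunit p-irr (unit-∣ p∣1))
irreducible-∣-prodₚ {p} (q ∷ L) irr p-irr p∣qL with euclid q (prodₚ L) p-irr p∣qL
... | inj₂ p∣L with irreducible-∣-prodₚ L (λ q' q'∈L → irr q' (there q'∈L)) p-irr p∣L
...   | q' , q'∈L , p≃q' = q' , there q'∈L , p≃q'
irreducible-∣-prodₚ {p} (q ∷ L) irr p-irr p∣qL | inj₁ (divides c cp≃q)
  with proj₂ (irr q (here refl)) c p (≃⇒≈ cp≃q)
... | inj₁ c≈1 = q , here refl , unit-factor (≈⇒≃ {c} {one} c≈1) cp≃q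
... | inj₂ p≈1 = ⊥-elim (irreducible-nonunit p-irr (≈⇒≃ {p} {one} p≈1))

len-ones : ∀ i → len (ones i) ≡ suc i
len-ones zero    = refl
len-ones (suc i) = len-cons true (ones i) (len-ones i)

ones-∣-Π₂ : ∀ {t} i → i < t → ones (suc i) ∣ Π₂ t
ones-∣-Π₂ {t} i i<t = ∣-*ˡ X (∈-∣-prodₚ (map (λ k → ones (suc k)) (upTo t))
                                        (∈-map⁺ (λ k → ones (suc k)) (∈-upTo⁺ i<t)))

len-ones-+ : ∀ i j → i ≢ j → len (ones i +ₚ ones j) ≡ suc (i ⊔ j)
len-ones-+ i j i≢j with <-cmp i j
... | tri< i<j _ _ =
  trans (len-+-< (ones i) (ones j) (subst₂ _<_ (sym (len-ones i)) (sym (len-ones j)) (s≤s i<j)))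
        (trans (len-ones j) (cong suc (sym (m≤n⇒m⊔n≡n (<⇒≤ i<j)))))
... | tri≈ _ i≡j _ = ⊥-elim (i≢j i≡j)
... | tri> _ _ j<i =
  trans (len-cong (+ₚ-comm (ones i) (ones j)))
  (trans (len-+-< (ones j) (ones i)
           (subst₂ _<_ (sym (len-ones j)) (sym (len-ones i)) (s≤s j<i)))
         (trans (len-ones i) (cong suc (sym (m≥n⇒m⊔n≡m (<⇒≤ j<i))))))

module Shifts (t : ℕ) (f : Poly) (f⊥Π₂ : Coprime f (Π₂ t)) (L : List Poly)
  (L-sound : ∀ p → p ∈ L → Irreducible p × DegLe p t × ¬ (p ∣ₚ f))
  (L-complete : ∀ p → Irreducible p → DegLe p t → ¬ (p ∣ₚ f) → Any (λ q → p ≈ q) L)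
  where

  P : Poly
  P = prodₚ L

  g : ℕ → Poly
  g i = f +ₚ ones i *ₚ P

  small-∣-P : ∀ {p} → Irreducible p → DegLe p t → ¬ p ∣ f → p ∣ P
  small-∣-P {p} p-irr p-small p∤f
    with find (L-complete p p-irr p-small (λ p∣f → p∤f (∣ₚ⇒∣ p∣f)))
  ... | q , q∈L , p≈q = ∣-resp (≃-sym (≈⇒≃ {p} {q} p≈q)) ≃-refl (∈-∣-prodₚ L q∈L)

  ∣-P-small : ∀ {p} → Irreducible p → p ∣ P → DegLe p t × ¬ p ∣ f
  ∣-P-small p-irr p∣P
    with irreducible-∣-prodₚ L (λ q q∈L → proj₁ (L-sound q q∈L)) p-irr p∣P
  ... | q , q∈L , p≃q with L-sound q q∈L
  ...   | _ , q-small , q∤f =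
    subst (_≤ suc t) (sym (len-cong p≃q)) q-small ,
    λ p∣f → q∤f (∣⇒∣ₚ (∣-resp p≃q ≃-refl p∣f))

  -- `f` is coprime to every shift `aᵢ` with `i ≤ t`: `a₀ = 1`, and the
  -- other shifts are factors of `Π₂ t`.
  f⊥ones : ∀ i → i ≤ t → ∀ {d} → d ∣ f → d ∣ ones i → d ≃ one
  f⊥ones zero    _     _   d∣1 = unit-∣ d∣1
  f⊥ones (suc i) i<t d∣f d∣a =
    ≈⇒≃ (f⊥Π₂ _ (∣⇒∣ₚ d∣f) (∣⇒∣ₚ (∣-trans d∣a (ones-∣-Π₂ i i<t))))

  -- If
  -- `p ∤ f` then `p ∣ P`, so `p ∣ g i - aᵢ·P = f`; if `p ∣ f` then
  -- `p ∣ aᵢ·P`, but `p ∤ aᵢ` (coprimality) and `p ∤ P` (as `p ∣ f`).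
  no-small-factor : ∀ i → i ≤ t → ∀ p → Irreducible p → DegLe p t → ¬ p ∣ g i
  no-small-factor i i≤t p p-irr p-small p∣g with ∣-dec p f
  ... | no p∤f = p∤f (∣-+-cancelʳ p∣g (∣-*ˡ (ones i) (small-∣-P p-irr p-small p∤f)))
  ... | yes p∣f with euclid (ones i) P p-irr (∣-+-cancelˡ p∣g p∣f)
  ...   | inj₁ p∣a = irreducible-nonunit p-irr (f⊥ones i i≤t p∣f p∣a)
  ...   | inj₂ p∣P = proj₂ (∣-P-small p-irr p∣P) p∣f

  g-+ : ∀ i j → g i +ₚ g j ≃ (ones i +ₚ ones j) *ₚ P
  g-+ i j = begin
    (f +ₚ ones i *ₚ P) +ₚ (f +ₚ ones j *ₚ P)  ≈⟨ +ₚ-interchange f _ f _ ⟩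
    (f +ₚ f) +ₚ (ones i *ₚ P +ₚ ones j *ₚ P)  ≈⟨ +ₚ-cong (+ₚ-self f) ≃-refl ⟩
    ones i *ₚ P +ₚ ones j *ₚ P                ≈⟨ *ₚ-distribʳ (ones i) (ones j) P ⟨
    (ones i +ₚ ones j) *ₚ P                   ∎
    where open ≃-Reasoning

  -- Second claim: for `i ≠ j` a non-unit common divisor of `g i` and `g j`
  -- has an irreducible factor `p ∣ g i + g j = (aᵢ + aⱼ)·P`.  Whether `p`
  -- divides `aᵢ + aⱼ ≠ 0` or `P`, its degree is at most `t`, contradicting
  -- the first claim.
  pairwise-coprime : ∀ i j → i ≤ t → j ≤ t → i ≢ j →
                     ∀ d → d ∣ g i → d ∣ g j → d ≃ one
  pairwise-coprime i j i≤t j≤t i≢j d d∣gi d∣gj with d ≃? one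
  ... | yes d≃1 = d≃1
  ... | no d≄1 with nonunit-irreducible-factor d d≄1
  ...   | p , p-irr , p∣d =
    ⊥-elim (no-small-factor i i≤t p p-irr (small (euclid (ones i +ₚ ones j) P p-irr p∣sum))
                            (∣-trans p∣d d∣gi))
    where
    p∣sum : p ∣ (ones i +ₚ ones j) *ₚ P
    p∣sum = ∣-resp ≃-refl (g-+ i j) (∣-trans p∣d (∣-+ d∣gi d∣gj))
    small : p ∣ ones i +ₚ ones j ⊎ p ∣ P → DegLe p t
    small (inj₁ p∣a) =
      ≤-trans (len-∣ (λ a≃0 → 0≢1+n (trans (sym (len-cong a≃0)) (len-ones-+ i j i≢j))) p∣a)
              (≤-trans (≤-reflexive (len-ones-+ i j i≢j)) (s≤s (⊔-lub i≤t j≤t)))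
    small (inj₂ p∣P) = proj₁ (∣-P-small p-irr p∣P)

-- The degree bound on `f`, `1 ≤ t` and the distinctness of the entries of
-- `L` are not needed for the two claims.
lemma4p1 : (n t : ℕ) → 1 ≤ t → (f : Poly) → Coprime f (Π₂ t) → DegLe f n →
  (L : List Poly) →
  (∀ p → p ∈ L → Irreducible p × DegLe p t × ¬ (p ∣ₚ f)) →
  (∀ p → Irreducible p → DegLe p t → ¬ (p ∣ₚ f) → Any (λ q → p ≈ q) L) →
  AllPairs (λ p q → ¬ (p ≈ q)) L →
  (∀ i → i ≤ t → ∀ p → Irreducible p → DegLe p t →
    ¬ (p ∣ₚ (f +ₚ ones i *ₚ prodₚ L)))
  × (∀ i j → i ≤ t → j ≤ t → i ≢ j →
    Coprime (f +ₚ ones i *ₚ prodₚ L) (f +ₚ ones j *ₚ prodₚ L))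
lemma4p1 _ t _ f f⊥Π₂ _ L L-sound L-complete _ =
  (λ i i≤t p p-irr p-small p∣g → no-small-factor i i≤t p p-irr p-small (∣ₚ⇒∣ p∣g)) ,
  (λ i j i≤t j≤t i≢j d d∣gi d∣gj →
    ≃⇒≈ (pairwise-coprime i j i≤t j≤t i≢j d (∣ₚ⇒∣ d∣gi) (∣ₚ⇒∣ d∣gj)))
  where open Shifts t f f⊥Π₂ L L-sound L-complete
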